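{- If $B\subseteq\mathbb{N}$ is highly sparse, then there exists a pair of sparseness rates $(f,g)$ of $B$ such that $g(a)\to\infty$ as $a\to\infty$.
   Context: $\mathbb{N}=\{1,2,3,\ldots\}$. A set $B\subseteq\mathbb{N}$ is highly sparse if there exist an increasing function $f:\mathbb{N}\to\mathbb{N}$ and an increasing function $g:\mathbb{N}\to\mathbb{R}_{\ge0}$ such that (1) $f(a)/a\to0$ as $a\to\infty$, and (2) for all sufficiently large $a$, for any $b_t,b_s\in B$ with $f(a)<b_t<b_s$ we have $b_s-b_t\ge a+g(a)$. Such a pair $(f,g)$ is called a pair of sparseness rates of $B$.
   Formalization: The function g in a pair of sparseness rates takes values in the nonnegative rationals instead of $\mathbb{R}_{\ge0}$. -}

module Defs where

open import Data.Nat using (ℕ; _≤_; _<_)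
open import Data.Integer using (+_)
open import Data.Rational using (ℚ; _/_; 0ℚ; _+_; _-_; _*_)
  renaming (_≤_ to _≤ℚ_; _<_ to _<ℚ_)
open import Data.Product using (Σ; _×_)

-- ℕ in the paper is {1,2,3,...}; we use Agda's ℕ and restrict every
-- quantifier / domain condition to positive numbers explicitly.

ι : ℕ → ℚ
ι n = (+ n) / 1

SubsetPos : (ℕ → Set) → Set
SubsetPos B = ∀ b → B b → 1 ≤ b

-- f : ℕ⁺ → ℕ⁺ increasing (= non-decreasing; strictly increasing would
-- contradict f(a)/a → 0)
IncreasingPosℕ : (ℕ → ℕ) → Set
IncreasingPosℕ f = (∀ a → 1 ≤ a → 1 ≤ f a) × (∀ m n → 1 ≤ m → m ≤ n → f m ≤ f n)

-- g : ℕ⁺ → ℝ_{≥0} increasing (non-decreasing); values taken in ℚ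
IncreasingNonnegℚ : (ℕ → ℚ) → Set
IncreasingNonnegℚ g = (∀ a → 1 ≤ a → 0ℚ ≤ℚ g a) × (∀ m n → 1 ≤ m → m ≤ n → g m ≤ℚ g n)

-- f(a)/a → 0 : for every ε > 0 there is N with |f(a)/a| < ε for a ≥ N,
-- i.e. f(a) < ε·a (a ≥ 1)
RatioToZero : (ℕ → ℕ) → Set
RatioToZero f = ∀ (ε : ℚ) → 0ℚ <ℚ ε →
  Σ ℕ λ N → 1 ≤ N × (∀ a → N ≤ a → ι (f a) <ℚ ε * ι a)

TendsToInfinity : (ℕ → ℚ) → Set
TendsToInfinity g = ∀ (M : ℚ) → Σ ℕ λ N → 1 ≤ N × (∀ a → N ≤ a → M <ℚ g a)

SparsenessRates : (ℕ → Set) → (ℕ → ℕ) → (ℕ → ℚ) → Set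
SparsenessRates B f g =
  IncreasingPosℕ f × IncreasingNonnegℚ g × RatioToZero f ×
  (Σ ℕ λ A → 1 ≤ A × (∀ a → A ≤ a → ∀ bt bs → B bt → B bs →
     f a < bt → bt < bs → (ι a + g a) ≤ℚ (ι bs - ι bt)))

HighlySparse : (ℕ → Set) → Set
HighlySparse B = Σ (ℕ → ℕ) λ f → Σ (ℕ → ℚ) λ g → SparsenessRates B f g

-- Doubling the argument of f frees a gap of a + a beyond the threshold f(2a):
-- for a past the old threshold, b_s − b_t ≥ 2a + g(2a) ≥ a + a.  Hence
-- (a ↦ f(2a), a ↦ a) is again a pair of sparseness rates, and f(2a)/a → 0
-- because f(a)/a → 0 (use ε/2 for f).  The new g is the identity, which
-- tends to infinity.
module Submission where

open import Defs
open import Data.Nat using (ℕ; suc; z≤n; s≤s)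
import Data.Nat as ℕ
import Data.Nat.Properties as ℕ
open import Data.Nat.Coprimality using (1-coprimeTo) renaming (sym to coprime-sym)
open import Data.Integer using (+_; -[1+_]; ∣_∣)
import Data.Integer as ℤ
import Data.Integer.Properties as ℤ
open import Data.Rational using (ℚ; mkℚ; ↥_; 0ℚ; 1ℚ; ½; _+_; _-_; _*_; toℚᵘ; *≤*; *<*)
  renaming (_≤_ to _≤ℚ_; _<_ to _<ℚ_)
open import Data.Rational.Properties
import Data.Rational.Unnormalised as ℚᵘ
import Data.Rational.Unnormalised.Properties as ℚᵘ
open import Data.Product using (Σ; _×_; _,_)
open import Relation.Binary.PropositionalEquality

double : ℕ → ℕ
double a = a ℕ.+ a

a≤double : ∀ a → a ℕ.≤ double a
a≤double a = ℕ.m≤m+n a a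

ι≡mkℚ : ∀ n → ι n ≡ mkℚ (+ n) 0 (coprime-sym (1-coprimeTo n))
ι≡mkℚ n = normalize-coprime (coprime-sym (1-coprimeTo n))

ι-mono-≤ : ∀ {m n} → m ℕ.≤ n → ι m ≤ℚ ι n
ι-mono-≤ {m} {n} m≤n rewrite ι≡mkℚ m | ι≡mkℚ n =
  *≤* (subst₂ ℤ._≤_ (sym (ℤ.*-identityʳ (+ m))) (sym (ℤ.*-identityʳ (+ n))) (ℤ.+≤+ m≤n))

ι-homo-+ : ∀ m n → ι (m ℕ.+ n) ≡ ι m + ι n
ι-homo-+ m n = toℚᵘ-injective (ℚᵘ.≃-trans homo (ℚᵘ.≃-sym (toℚᵘ-homo-+ (ι m) (ι n))))
  where
  homo : toℚᵘ (ι (m ℕ.+ n)) ℚᵘ.≃ toℚᵘ (ι m) ℚᵘ.+ toℚᵘ (ι n)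
  homo rewrite ι≡mkℚ m | ι≡mkℚ n | ι≡mkℚ (m ℕ.+ n) =
    ℚᵘ.*≡* (trans (ℤ.*-identityʳ _)
      (trans (cong₂ ℤ._+_ (sym (ℤ.*-identityʳ (+ m))) (sym (ℤ.*-identityʳ (+ n))))
             (sym (ℤ.*-identityʳ _))))

ι-double : ∀ a → ι (double a) ≡ ι a + ι a
ι-double a = ι-homo-+ a a

ι-increasingNonneg : IncreasingNonnegℚ ι
ι-increasingNonneg = (λ a _ → ι-mono-≤ {0} {a} z≤n) , (λ _ _ _ → ι-mono-≤)

-- Archimedean property: any a beyond 1 + |numerator of M| exceeds M.
ι-tendsToInfinity : TendsToInfinity ι
ι-tendsToInfinity M = suc ∣ ↥ M ∣ , s≤s z≤n , exceeds M
  where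
  exceeds : ∀ M a → suc ∣ ↥ M ∣ ℕ.≤ a → M <ℚ ι a
  exceeds (mkℚ (+ n) d _) a n<a rewrite ι≡mkℚ a =
    *<* (subst₂ ℤ._<_ (sym (ℤ.*-identityʳ (+ n))) (ℤ.pos-* a (suc d))
      (ℤ.+<+ (ℕ.<-≤-trans n<a (ℕ.m≤m*n a (suc d)))))
  exceeds (mkℚ -[1+ n ] d _) a _ rewrite ι≡mkℚ a =
    *<* (subst₂ ℤ._<_ (sym (ℤ.*-identityʳ -[1+ n ])) (ℤ.pos-* a (suc d)) ℤ.-<+)

half-pos : ∀ {ε} → 0ℚ <ℚ ε → 0ℚ <ℚ ε * ½
half-pos {ε} 0<ε = subst (_<ℚ ε * ½) (*-zeroˡ ½) (*-monoˡ-<-pos ½ 0<ε)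

half-*-double : ∀ ε x → (ε * ½) * (x + x) ≡ ε * x
half-*-double ε x = begin
  (ε * ½) * (x + x)    ≡⟨ *-assoc ε ½ (x + x) ⟩
  ε * (½ * (x + x))    ≡⟨ cong (ε *_) (*-distribˡ-+ ½ x x) ⟩
  ε * (½ * x + ½ * x)  ≡⟨ cong (ε *_) (*-distribʳ-+ x ½ ½) ⟨
  ε * (1ℚ * x)         ≡⟨ cong (ε *_) (*-identityˡ x) ⟩
  ε * x                ∎
  where open ≡-Reasoning

increasingPosℕ-∘-double : ∀ {f} → IncreasingPosℕ f → IncreasingPosℕ (λ a → f (double a))
increasingPosℕ-∘-double (f-pos , f-mono) =
  (λ a 1≤a → f-pos (double a) (ℕ.≤-trans 1≤a (a≤double a))) ,
  (λ m n 1≤m m≤n → f-mono (double m) (double n) (ℕ.≤-trans 1≤m (a≤double m)) (ℕ.+-mono-≤ m≤n m≤n))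

ratioToZero-∘-double : ∀ {f} → RatioToZero f → RatioToZero (λ a → f (double a))
ratioToZero-∘-double {f} ratio ε 0<ε with ratio (ε * ½) (half-pos 0<ε)
... | N , 1≤N , small = N , 1≤N , λ a N≤a →
  subst (ι (f (double a)) <ℚ_) (trans (cong ((ε * ½) *_) (ι-double a)) (half-*-double ε (ι a)))
    (small (double a) (ℕ.≤-trans N≤a (a≤double a)))

sparsenessRates-∘-double : ∀ {B f g} → SparsenessRates B f g →
  SparsenessRates B (λ a → f (double a)) ι
sparsenessRates-∘-double {B} {f} {g} (f-inc , (g-nonneg , _) , ratio , A , 1≤A , gap) =
  increasingPosℕ-∘-double f-inc , ι-increasingNonneg , ratioToZero-∘-double {f} ratio ,
  A , 1≤A , gap′
  where
  gap′ : ∀ a → A ℕ.≤ a → ∀ bt bs → B bt → B bs →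
    f (double a) ℕ.< bt → bt ℕ.< bs → ι a + ι a ≤ℚ ι bs - ι bt
  gap′ a A≤a bt bs Bt Bs ft<bt bt<bs = begin
    ι a + ι a                    ≡⟨ ι-double a ⟨
    ι (double a)                 ≡⟨ +-identityʳ (ι (double a)) ⟨
    ι (double a) + 0ℚ            ≤⟨ +-monoʳ-≤ (ι (double a)) (g-nonneg (double a) 1≤2a) ⟩
    ι (double a) + g (double a)  ≤⟨ gap (double a) A≤2a bt bs Bt Bs ft<bt bt<bs ⟩
    ι bs - ι bt                  ∎
    where
    open ≤-Reasoning
    A≤2a : A ℕ.≤ double a
    A≤2a = ℕ.≤-trans A≤a (a≤double a)
    1≤2a : 1 ℕ.≤ double a
    1≤2a = ℕ.≤-trans 1≤A A≤2a

lemma3p1 : (B : ℕ → Set) → SubsetPos B → HighlySparse B →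
    Σ (ℕ → ℕ) λ f → Σ (ℕ → ℚ) λ g → SparsenessRates B f g × TendsToInfinity g
lemma3p1 B _ (f , g , rates) =
  (λ a → f (double a)) , ι , sparsenessRates-∘-double rates , ι-tendsToInfinity
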